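{- Let $k\ge2$ and $\beta>0$. Let $G$ be an $n$-vertex $k$-graph, and let $e=\{v_1,\dots,v_k\}$ and $f=\{u_1,\dots,u_k\}$ be two edges of $G$ intersecting in the single vertex $u_1=v_1$. Suppose each of $u_2,\dots,u_k,v_2,\dots,v_k$ has degree (number of edges containing it) at least $(1/2+\beta)\binom{n-1}{k-1}$. Then, if $n$ is sufficiently large in terms of $k$ and $\beta$, there is a shifting structure on $(e,f)$.
   Context: A $k$-graph has an edge set of $k$-element vertex subsets. Let $e=\{v_1,\dots,v_k\}$ and $f=\{u_1,\dots,u_k\}$ be edges with $e\cap f=\{v_1\}=\{u_1\}$. A shifting structure on $(e,f)$ is a sequence $(U_2,\dots,U_k)$ of $(k-1)$-element vertex sets such that no $U_i$ shares a vertex with $e$ or $f$, the sets $U_2,\dots,U_k$ are pairwise disjoint, and for each $2\le i\le k$ both $U_i\cup\{u_i\}$ and $U_i\cup\{v_i\}$ are edges of $G$.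
   Formalization: The parameter β ranges over the positive rationals. -}

module Defs where

open import Data.Bool using (Bool; true; false; _∧_; if_then_else_)
open import Data.Nat using (ℕ; zero; suc; _≤_; s≤s; _∸_)
open import Data.Fin using (Fin; zero; suc)
open import Data.Fin.Subset using (Subset; _∈_; _∉_; _∪_; ⁅_⁆; ∣_∣)
open import Data.Fin.Subset.Properties using (_∈?_)
open import Data.List using (List; []; _∷_; _++_; map)
open import Data.Nat.ListAction using (sum)
open import Data.Vec using ([]; _∷_)
open import Data.Product using (Σ; _×_; ∃; _,_)
open import Relation.Nullary.Decidable using (⌊_⌋)
open import Relation.Binary.PropositionalEquality using (_≡_; _≢_)
open import Function.Bundles using (_⇔_)
open import Function.Definitions using (Injective)

record KGraph (k n : ℕ) : Set where
  field
    isEdge   : Subset n → Bool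
    edgeSize : ∀ s → isEdge s ≡ true → ∣ s ∣ ≡ k
open KGraph public

allSubsets : (n : ℕ) → List (Subset n)
allSubsets zero    = [] ∷ []
allSubsets (suc n) = map (true ∷_) (allSubsets n) ++ map (false ∷_) (allSubsets n)

degree : ∀ {k n} → KGraph k n → Fin n → ℕ
degree {n = n} G x =
  sum (map (λ s → if isEdge G s ∧ ⌊ x ∈? s ⌋ then 1 else 0) (allSubsets n))

Disjoint : ∀ {n} → Subset n → Subset n → Set
Disjoint A B = ∀ x → x ∈ A → x ∉ B

-- the index of the first vertex v₁ (labelings are indexed by Fin k, k ≥ 2)
first : ∀ {k} → 2 ≤ k → Fin k
first (s≤s _) = zero

Enumerates : ∀ {k n} → (Fin k → Fin n) → Subset n → Set
Enumerates v e = Injective _≡_ _≡_ v × (∀ x → (x ∈ e) ⇔ (∃ λ i → v i ≡ x))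

-- shifting structure (U₂,…,U_k) on (e,f) with enumerations v of e and u of f;
-- U is indexed by Fin k, only indices i ≢ first are used.
ShiftingStructure : ∀ {k n} → (hk : 2 ≤ k) → KGraph k n →
  (e f : Subset n) (v u : Fin k → Fin n) → Set
ShiftingStructure {k} {n} hk G e f v u =
  Σ (Fin k → Subset n) λ U →
    (∀ i → i ≢ first hk → ∣ U i ∣ ≡ k ∸ 1) ×
    (∀ i → i ≢ first hk → Disjoint (U i) e × Disjoint (U i) f) ×
    (∀ i j → i ≢ first hk → j ≢ first hk → i ≢ j → Disjoint (U i) (U j)) ×
    (∀ i → i ≢ first hk →
       (isEdge G (U i ∪ ⁅ u i ⁆) ≡ true) × (isEdge G (U i ∪ ⁅ v i ⁆) ≡ true))

module Submission where

-- The degree of a vertex a counts the (k-1)-sets T ∌ a whose union with a is an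
-- edge (the link of a).  Double counting over all (k-1)-sets gives
--   deg u + deg v ≤ #(common links of u and v avoiding F) + C(n,k-1) + |F|·C(n-1,k-2),
-- while the degree condition gives deg u + deg v ≥ (1+2β)·C(n-1,k-1).  Since
-- C(n-1,k-1)/C(n-1,k-2) = (n-k+1)/(k-1) grows with n, for large n every pair
-- u_i, v_i has a common link avoiding any forbidden set F of bounded size.  So
-- U_2, …, U_k can be chosen greedily, each avoiding e ∪ f and the sets chosen
-- before it; the forbidden set never exceeds 2k + (k-1)² vertices.

module _ where

  open import Algebra.Properties.CommutativeSemigroup using (interchange)
  open import Data.Bool.Base using (Bool; true; false; not; _∧_; _∨_; if_then_else_)
  open import Data.Bool.Properties using (∧-zeroʳ; ∧-identityʳ; ∧-conicalˡ; ∧-conicalʳ; ∨-conicalʳ; not-involutive; T-≡)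
  open import Data.Empty using (⊥-elim)
  open import Data.Fin.Base using (Fin; zero; suc)
  open import Data.Fin.Subset using (Subset; _∪_; ⁅_⁆; ∣_∣; ⊥)
  open import Data.Fin.Subset.Properties using (_∈?_; ∪-identityʳ; p⊆p∪q; q⊆p∪q)
  open import Data.Integer.Base as ℤ using (+_)
  import Data.Integer.Properties as ℤ
  open import Data.List.Base using (map; _++_)
  open import Data.List.Properties using (map-++; map-∘)
  open import Data.Nat.Base
  open import Data.Nat.Combinatorics using (_C_; nCk+nC[k+1]≡[n+1]C[k+1]; nC1≡n)
  open import Data.Nat.Coprimality using (Coprime; 1-coprimeTo)
  import Data.Nat.Coprimality as Coprime
  open import Data.Nat.ListAction using (sum)
  open import Data.Nat.ListAction.Properties using (sum-++)
  open import Data.Nat.Properties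
  open import Data.Nat.Tactic.RingSolver using (solve-∀)
  open import Data.Product.Base using (∃; _×_; _,_; proj₁; proj₂)
  open import Data.Rational.Base as ℚ using (mkℚ; ½; toℚᵘ)
  import Data.Rational.Properties as ℚ
  open import Data.Rational.Unnormalised.Base as ℚᵘ using (mkℚᵘ; *≤*)
  import Data.Rational.Unnormalised.Properties as ℚᵘ
  open import Data.Vec.Base using ([]; _∷_; here; there)
  open import Function.Base using (_∘_)
  open import Function.Bundles using (Equivalence)
  open import Relation.Binary.PropositionalEquality
  open import Relation.Nullary.Decidable using (does; ⌊_⌋; isYes≗does)
  open import Defs

  indicator : Bool → ℕ
  indicator b = if b then 1 else 0

  ∑ : ∀ {n} → (Subset n → ℕ) → ℕ
  ∑ {zero}  g = g []
  ∑ {suc n} g = ∑ (g ∘ (true ∷_)) + ∑ (g ∘ (false ∷_))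

  sum-allSubsets : ∀ n (g : Subset n → ℕ) → sum (map g (allSubsets n)) ≡ ∑ g
  sum-allSubsets zero    g = +-identityʳ (g [])
  sum-allSubsets (suc n) g = begin
    sum (map g (map (true ∷_) xs ++ map (false ∷_) xs))                ≡⟨ cong sum (map-++ g (map (true ∷_) xs) _) ⟩
    sum (map g (map (true ∷_) xs) ++ map g (map (false ∷_) xs))        ≡⟨ sum-++ (map g (map (true ∷_) xs)) _ ⟩
    sum (map g (map (true ∷_) xs)) + sum (map g (map (false ∷_) xs))   ≡⟨ cong₂ _+_ (half true) (half false) ⟩
    ∑ g                                                                ∎
    where
    open ≡-Reasoning
    xs = allSubsets n
    half : ∀ b → sum (map g (map (b ∷_) xs)) ≡ ∑ (g ∘ (b ∷_))
    half b = trans (cong sum (sym (map-∘ xs))) (sum-allSubsets n (g ∘ (b ∷_)))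

  ∑-mono-≤ : ∀ {n} {g h : Subset n → ℕ} → (∀ s → g s ≤ h s) → ∑ g ≤ ∑ h
  ∑-mono-≤ {zero}  g≤h = g≤h []
  ∑-mono-≤ {suc n} g≤h = +-mono-≤ (∑-mono-≤ (g≤h ∘ (true ∷_))) (∑-mono-≤ (g≤h ∘ (false ∷_)))

  ∑-cong : ∀ {n} {g h : Subset n → ℕ} → (∀ s → g s ≡ h s) → ∑ g ≡ ∑ h
  ∑-cong {zero}  g≡h = g≡h []
  ∑-cong {suc n} g≡h = cong₂ _+_ (∑-cong (g≡h ∘ (true ∷_))) (∑-cong (g≡h ∘ (false ∷_)))

  ∑-zero : ∀ n → ∑ {n} (λ _ → 0) ≡ 0
  ∑-zero zero    = refl
  ∑-zero (suc n) = cong₂ _+_ (∑-zero n) (∑-zero n)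

  ∑-distrib-+ : ∀ {n} (g h : Subset n → ℕ) → ∑ (λ s → g s + h s) ≡ ∑ g + ∑ h
  ∑-distrib-+ {zero}  g h = refl
  ∑-distrib-+ {suc n} g h = trans
    (cong₂ _+_ (∑-distrib-+ (g ∘ (true ∷_)) (h ∘ (true ∷_))) (∑-distrib-+ (g ∘ (false ∷_)) (h ∘ (false ∷_))))
    (interchange +-commutativeSemigroup (∑ (g ∘ (true ∷_))) _ _ _)

  ∑-witness : ∀ {n} (g : Subset n → ℕ) → 0 < ∑ g → ∃ λ s → 0 < g s
  ∑-witness {zero}  g pos = [] , pos
  ∑-witness {suc n} g pos with ∑ (g ∘ (true ∷_)) | ∑-witness (g ∘ (true ∷_))
  ... | zero  | _ = let s , 0<g = ∑-witness (g ∘ (false ∷_)) pos in false ∷ s , 0<g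
  ... | suc _ | w = let s , 0<g = w z<s in true ∷ s , 0<g

  toggle : ∀ {n} → Fin n → Subset n → Subset n
  toggle zero    (b ∷ s) = not b ∷ s
  toggle (suc x) (b ∷ s) = b ∷ toggle x s

  ∑-toggle : ∀ {n} (x : Fin n) (g : Subset n → ℕ) → ∑ g ≡ ∑ (g ∘ toggle x)
  ∑-toggle zero    g = +-comm (∑ (g ∘ (true ∷_))) _
  ∑-toggle (suc x) g = cong₂ _+_ (∑-toggle x (g ∘ (true ∷_))) (∑-toggle x (g ∘ (false ∷_)))

  ∈?-toggle : ∀ {n} (x : Fin n) s → does (x ∈? toggle x s) ≡ not (does (x ∈? s))
  ∈?-toggle zero    (true  ∷ s) = refl
  ∈?-toggle zero    (false ∷ s) = refl
  ∈?-toggle (suc x) (b     ∷ s) = ∈?-toggle x s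

  toggle-∉ : ∀ {n} (x : Fin n) s → does (x ∈? s) ≡ false → toggle x s ≡ s ∪ ⁅ x ⁆
  toggle-∉ zero    (false ∷ s) _   = cong (true ∷_) (sym (∪-identityʳ s))
  toggle-∉ (suc x) (true  ∷ s) x∉s = cong (true ∷_) (toggle-∉ x s x∉s)
  toggle-∉ (suc x) (false ∷ s) x∉s = cong (false ∷_) (toggle-∉ x s x∉s)

  ∣toggle-∉∣ : ∀ {n} (x : Fin n) s → does (x ∈? s) ≡ false → ∣ toggle x s ∣ ≡ suc ∣ s ∣
  ∣toggle-∉∣ zero    (false ∷ s) _   = refl
  ∣toggle-∉∣ (suc x) (true  ∷ s) x∉s = cong suc (∣toggle-∉∣ x s x∉s)
  ∣toggle-∉∣ (suc x) (false ∷ s) x∉s = ∣toggle-∉∣ x s x∉s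

  meets : ∀ {n} → Subset n → Subset n → Bool
  meets []      []      = false
  meets (a ∷ s) (b ∷ t) = (a ∧ b) ∨ meets s t

  meets≡false⇒Disjoint : ∀ {n} (s t : Subset n) → meets s t ≡ false → Disjoint s t
  meets≡false⇒Disjoint (true ∷ s) (true ∷ t) ()    zero    here        here
  meets≡false⇒Disjoint (a    ∷ s) (b    ∷ t) s∩t=∅ (suc x) (there x∈s) (there x∈t) =
    meets≡false⇒Disjoint s t (∨-conicalʳ (a ∧ b) _ s∩t=∅) x x∈s x∈t

  ∣p∪q∣≤∣p∣+∣q∣ : ∀ {n} (p q : Subset n) → ∣ p ∪ q ∣ ≤ ∣ p ∣ + ∣ q ∣
  ∣p∪q∣≤∣p∣+∣q∣ []          []          = z≤n
  ∣p∪q∣≤∣p∣+∣q∣ (true  ∷ p) (true  ∷ q) = s≤s (≤-trans (∣p∪q∣≤∣p∣+∣q∣ p q) (+-monoʳ-≤ ∣ p ∣ (n≤1+n ∣ q ∣)))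
  ∣p∪q∣≤∣p∣+∣q∣ (true  ∷ p) (false ∷ q) = s≤s (∣p∪q∣≤∣p∣+∣q∣ p q)
  ∣p∪q∣≤∣p∣+∣q∣ (false ∷ p) (true  ∷ q) = ≤-trans (s≤s (∣p∪q∣≤∣p∣+∣q∣ p q)) (≤-reflexive (sym (+-suc ∣ p ∣ ∣ q ∣)))
  ∣p∪q∣≤∣p∣+∣q∣ (false ∷ p) (false ∷ q) = ∣p∪q∣≤∣p∣+∣q∣ p q

  ∑-size≡C : ∀ n i → ∑ {n} (λ s → indicator (∣ s ∣ ≡ᵇ i)) ≡ n C i
  ∑-size≡C zero    zero    = refl
  ∑-size≡C zero    (suc i) = refl
  ∑-size≡C (suc n) zero    = cong₂ _+_ (∑-zero n) (∑-size≡C n zero)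
  ∑-size≡C (suc n) (suc i) = trans (cong₂ _+_ (∑-size≡C n i) (∑-size≡C n (suc i))) (nCk+nC[k+1]≡[n+1]C[k+1] n i)

  indicator-∧≤ : ∀ a b → indicator (a ∧ b) ≤ indicator a
  indicator-∧≤ false _     = z≤n
  indicator-∧≤ true  false = z≤n
  indicator-∧≤ true  true  = ≤-refl

  nCk≤[n+1]Ck : ∀ n k → n C k ≤ suc n C k
  nCk≤[n+1]Ck n zero    = ≤-refl
  nCk≤[n+1]Ck n (suc k) = ≤-trans (m≤n+m (n C suc k) (n C k)) (≤-reflexive (nCk+nC[k+1]≡[n+1]C[k+1] n k))

  k≤n⇒0<nCk : ∀ {n k} → k ≤ n → 0 < n C k
  k≤n⇒0<nCk {n} {zero}  _         = z<s
  k≤n⇒0<nCk {suc n} {suc k} (s≤s k≤n) =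
    <-≤-trans (k≤n⇒0<nCk k≤n) (≤-trans (m≤m+n (n C k) _) (≤-reflexive (nCk+nC[k+1]≡[n+1]C[k+1] n k)))

  [k+1]*[n+1]C[k+1]≡[n+1]*nCk : ∀ n k → suc k * (suc n C suc k) ≡ suc n * (n C k)
  [k+1]*[n+1]C[k+1]≡[n+1]*nCk zero    zero    = refl
  [k+1]*[n+1]C[k+1]≡[n+1]*nCk zero    (suc k) = *-zeroʳ (2 + k)
  [k+1]*[n+1]C[k+1]≡[n+1]*nCk (suc n) zero    = begin
    1 * ((2 + n) C 1) ≡⟨ *-identityˡ _ ⟩
    (2 + n) C 1       ≡⟨ nC1≡n (2 + n) ⟩
    2 + n             ≡⟨ *-identityʳ (2 + n) ⟨
    (2 + n) * 1       ∎
    where open ≡-Reasoning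
  [k+1]*[n+1]C[k+1]≡[n+1]*nCk (suc n) (suc k) = begin
    (2 + k) * ((2 + n) C (2 + k))               ≡⟨ cong ((2 + k) *_) (nCk+nC[k+1]≡[n+1]C[k+1] (suc n) (suc k)) ⟨
    (2 + k) * (Z + Y)                           ≡⟨ *-distribˡ-+ (2 + k) Z Y ⟩
    Z + (1 + k) * Z + (2 + k) * Y               ≡⟨ cong₂ (λ x y → Z + x + y) (ih k) (ih (suc k)) ⟩
    Z + (1 + n) * (n C k) + (1 + n) * (n C suc k) ≡⟨ +-assoc Z _ _ ⟩
    Z + ((1 + n) * (n C k) + (1 + n) * (n C suc k)) ≡⟨ cong (λ x → Z + x) (*-distribˡ-+ (1 + n) (n C k) _) ⟨
    Z + (1 + n) * (n C k + n C suc k)           ≡⟨ cong (λ x → Z + (1 + n) * x) (nCk+nC[k+1]≡[n+1]C[k+1] n k) ⟩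
    (2 + n) * Z                                 ∎
    where
    open ≡-Reasoning
    ih = [k+1]*[n+1]C[k+1]≡[n+1]*nCk n
    Z = suc n C suc k
    Y = suc n C suc (suc k)

  meeting : ∀ {n} → ℕ → Subset n → Subset n → ℕ
  meeting i F s = indicator ((∣ s ∣ ≡ᵇ i) ∧ meets s F)

  ∑-meeting-empty : ∀ {n} (F : Subset n) → ∑ (meeting 0 F) ≡ 0
  ∑-meeting-empty []      = refl
  ∑-meeting-empty {suc n} (_ ∷ F) = cong₂ _+_ (∑-zero n) (∑-meeting-empty F)

  ∑-meeting≤ : ∀ m i (F : Subset (suc m)) → ∑ (meeting (suc i) F) ≤ ∣ F ∣ * (m C i)
  ∑-meeting≤ zero    zero    (true  ∷ []) = ≤-refl
  ∑-meeting≤ zero    zero    (false ∷ []) = z≤n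
  ∑-meeting≤ zero    (suc i) (_     ∷ []) = z≤n
  ∑-meeting≤ (suc m) i       (true  ∷ F)  = begin
    ∑ {suc m} (λ s → indicator ((∣ s ∣ ≡ᵇ i) ∧ true)) + ∑ (meeting (suc i) F)
      ≤⟨ +-mono-≤ (∑-mono-≤ {suc m} (λ s → indicator-∧≤ (∣ s ∣ ≡ᵇ i) true)) (∑-meeting≤ m i F) ⟩
    ∑ {suc m} (λ s → indicator (∣ s ∣ ≡ᵇ i)) + ∣ F ∣ * (m C i)
      ≤⟨ +-mono-≤ (≤-reflexive (∑-size≡C (suc m) i)) (*-monoʳ-≤ ∣ F ∣ (nCk≤[n+1]Ck m i)) ⟩
    suc m C i + ∣ F ∣ * (suc m C i) ∎
    where open ≤-Reasoning
  ∑-meeting≤ (suc m) zero    (false ∷ F)  = begin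
    ∑ (meeting 0 F) + ∑ (meeting 1 F)  ≡⟨ cong (_+ ∑ (meeting 1 F)) (∑-meeting-empty F) ⟩
    ∑ (meeting 1 F)                    ≤⟨ ∑-meeting≤ m zero F ⟩
    ∣ F ∣ * (m C 0)                    ∎
    where open ≤-Reasoning
  ∑-meeting≤ (suc m) (suc i) (false ∷ F)  = begin
    ∑ (meeting (suc i) F) + ∑ (meeting (2 + i) F)  ≤⟨ +-mono-≤ (∑-meeting≤ m i F) (∑-meeting≤ m (suc i) F) ⟩
    ∣ F ∣ * (m C i) + ∣ F ∣ * (m C suc i)           ≡⟨ *-distribˡ-+ ∣ F ∣ (m C i) _ ⟨
    ∣ F ∣ * (m C i + m C suc i)                    ≡⟨ cong (∣ F ∣ *_) (nCk+nC[k+1]≡[n+1]C[k+1] m i) ⟩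
    ∣ F ∣ * (suc m C suc i)                        ∎
    where open ≤-Reasoning

  link : ∀ {k n} → KGraph k n → Fin n → Subset n → Bool
  link G a s = not (does (a ∈? s)) ∧ isEdge G (s ∪ ⁅ a ⁆)

  degree≡∑link : ∀ {k n} (G : KGraph k n) (a : Fin n) → degree G a ≡ ∑ (indicator ∘ link G a)
  degree≡∑link {n = n} G a = begin
    degree G a                  ≡⟨ sum-allSubsets n containing ⟩
    ∑ containing                ≡⟨ ∑-toggle a containing ⟩
    ∑ (containing ∘ toggle a)   ≡⟨ ∑-cong (cong indicator ∘ toggle-containing≡link) ⟩
    ∑ (indicator ∘ link G a)    ∎
    where
    open ≡-Reasoning
    containing : Subset n → ℕ
    containing s = indicator (isEdge G s ∧ ⌊ a ∈? s ⌋)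
    toggle-containing≡link : ∀ s → isEdge G (toggle a s) ∧ ⌊ a ∈? toggle a s ⌋ ≡ link G a s
    toggle-containing≡link s rewrite isYes≗does (a ∈? toggle a s) | ∈?-toggle a s with does (a ∈? s) in a∉s
    ... | true  = ∧-zeroʳ _
    ... | false = trans (∧-identityʳ _) (cong (isEdge G) (toggle-∉ a s a∉s))

  link⇒∉ : ∀ {k n} (G : KGraph k n) a s → link G a s ≡ true → does (a ∈? s) ≡ false
  link⇒∉ G a s ab = trans (sym (not-involutive _)) (cong not (∧-conicalˡ _ _ ab))

  link⇒edge : ∀ {k n} (G : KGraph k n) a s → link G a s ≡ true → isEdge G (s ∪ ⁅ a ⁆) ≡ true
  link⇒edge G a s = ∧-conicalʳ _ _

  link⇒size : ∀ {k n} (G : KGraph (suc k) n) a s → link G a s ≡ true → ∣ s ∣ ≡ k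
  link⇒size G a s ab = suc-injective (begin
    suc ∣ s ∣          ≡⟨ ∣toggle-∉∣ a s a∉s ⟨
    ∣ toggle a s ∣     ≡⟨ cong ∣_∣ (toggle-∉ a s a∉s) ⟩
    ∣ s ∪ ⁅ a ⁆ ∣      ≡⟨ edgeSize G _ (link⇒edge G a s ab) ⟩
    suc _              ∎)
    where
    open ≡-Reasoning
    a∉s = link⇒∉ G a s ab

  -- A set in both links is counted twice on the right: by the size term z, and by the
  -- first term if it avoids F (d = false) or by the last term if it meets F.
  indicator-+≤ : ∀ a b z d → (a ≡ true → z ≡ true) → (b ≡ true → z ≡ true) →
    indicator a + indicator b ≤ indicator (a ∧ b ∧ not d) + indicator z + indicator (z ∧ d)
  indicator-+≤ false false _     _     _  _  = z≤n
  indicator-+≤ true  _     false _     a⇒z _  with () ← a⇒z refl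
  indicator-+≤ false true  false _     _  b⇒z with () ← b⇒z refl
  indicator-+≤ true  true  true  false _  _  = ≤-refl
  indicator-+≤ true  true  true  true  _  _  = ≤-refl
  indicator-+≤ true  false true  _     _  _  = s≤s z≤n
  indicator-+≤ false true  true  _     _  _  = s≤s z≤n

  indicator-∧∧not : ∀ x y z → 0 < indicator (x ∧ y ∧ not z) → x ≡ true × y ≡ true × z ≡ false
  indicator-∧∧not true  true  false _ = refl , refl , refl
  indicator-∧∧not true  true  true  ()
  indicator-∧∧not true  false _     ()
  indicator-∧∧not false _     _     ()

  commonAvoiding : ∀ {k n} → KGraph k n → Fin n → Fin n → Subset n → Subset n → Bool
  commonAvoiding G a b F s = link G a s ∧ link G b s ∧ not (meets s F)

  -- With k = 2 + j and n = suc m, the last two terms are C(n,k-1) and |F|·C(n-1,k-2).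
  degree+degree≤ : ∀ {j m} (G : KGraph (2 + j) (suc m)) F a b →
    degree G a + degree G b ≤ ∑ (indicator ∘ commonAvoiding G a b F) + (suc m C suc j + ∣ F ∣ * (m C j))
  degree+degree≤ {j} {m} G F a b = begin
    degree G a + degree G b
      ≡⟨ cong₂ _+_ (degree≡∑link G a) (degree≡∑link G b) ⟩
    ∑ (indicator ∘ link G a) + ∑ (indicator ∘ link G b)
      ≡⟨ ∑-distrib-+ (indicator ∘ link G a) (indicator ∘ link G b) ⟨
    ∑ (λ s → indicator (link G a s) + indicator (link G b s))
      ≤⟨ ∑-mono-≤ (λ s → indicator-+≤ _ _ (sized s) (meets s F) (link⇒sized a s) (link⇒sized b s)) ⟩
    ∑ (λ s → common s + indicator (sized s) + meeting (suc j) F s)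
      ≡⟨ ∑-distrib-+ (λ s → common s + indicator (sized s)) (meeting (suc j) F) ⟩
    ∑ (λ s → common s + indicator (sized s)) + ∑ (meeting (suc j) F)
      ≡⟨ cong (_+ ∑ (meeting (suc j) F)) (∑-distrib-+ common (indicator ∘ sized)) ⟩
    ∑ common + ∑ (indicator ∘ sized) + ∑ (meeting (suc j) F)
      ≤⟨ +-mono-≤ (+-monoʳ-≤ (∑ common) (≤-reflexive (∑-size≡C (suc m) (suc j)))) (∑-meeting≤ m j F) ⟩
    ∑ common + suc m C suc j + ∣ F ∣ * (m C j)
      ≡⟨ +-assoc (∑ common) _ _ ⟩
    ∑ common + (suc m C suc j + ∣ F ∣ * (m C j)) ∎
    where
    open ≤-Reasoning
    common : Subset (suc m) → ℕ
    common = indicator ∘ commonAvoiding G a b F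
    sized : Subset (suc m) → Bool
    sized s = ∣ s ∣ ≡ᵇ suc j
    link⇒sized : ∀ c s → link G c s ≡ true → sized s ≡ true
    link⇒sized c s cs = Equivalence.to T-≡ (≡⇒≡ᵇ _ _ (link⇒size G c s cs))

  CommonLink : ∀ {k n} → KGraph k n → Fin n → Fin n → Subset n → Set
  CommonLink G a b T = isEdge G (T ∪ ⁅ a ⁆) ≡ true × isEdge G (T ∪ ⁅ b ⁆) ≡ true

  commonLink-avoiding : ∀ {j m} (G : KGraph (2 + j) (suc m)) (F : Subset (suc m)) (a b : Fin (suc m)) →
    suc m C suc j + ∣ F ∣ * (m C j) < degree G a + degree G b →
    ∃ λ T → ∣ T ∣ ≡ suc j × Disjoint T F × CommonLink G a b T
  commonLink-avoiding G F a b large =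
    let T , 0<common   = ∑-witness (indicator ∘ commonAvoiding G a b F)
                            (+-cancelʳ-< _ 0 _ (<-≤-trans large (degree+degree≤ G F a b)))
        aT , bT , T∩F=∅ = indicator-∧∧not (link G a T) (link G b T) (meets T F) 0<common
    in T , link⇒size G a T aT , meets≡false⇒Disjoint T F T∩F=∅ , link⇒edge G a T aT , link⇒edge G b T bT

  PairwiseDisjoint : ∀ {r n} → (Fin r → Subset n) → Set
  PairwiseDisjoint W = ∀ i j → i ≢ j → Disjoint (W i) (W j)

  greedy : ∀ {n} r s M (P : Fin r → Subset n → Set) (F₀ : Subset n) → ∣ F₀ ∣ + r * s ≤ M →
    (∀ i F → ∣ F ∣ ≤ M → ∃ λ T → ∣ T ∣ ≡ s × Disjoint T F × P i T) →
    ∃ λ (W : Fin r → Subset n) → (∀ i → ∣ W i ∣ ≡ s × Disjoint (W i) F₀ × P i (W i)) × PairwiseDisjoint W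
  greedy zero    s M P F₀ _     _      = (λ ()) , (λ ()) , λ ()
  greedy (suc r) s M P F₀ bound choose = W , good , disjoint
    where
    choice₀ = choose zero F₀ (m+n≤o⇒m≤o ∣ F₀ ∣ bound)
    T₀ = proj₁ choice₀
    ∣T₀∣≡s = proj₁ (proj₂ choice₀)
    F₁ = F₀ ∪ T₀
    bound₁ : ∣ F₁ ∣ + r * s ≤ M
    bound₁ = begin
      ∣ F₀ ∪ T₀ ∣ + r * s      ≤⟨ +-monoˡ-≤ (r * s) (∣p∪q∣≤∣p∣+∣q∣ F₀ T₀) ⟩
      ∣ F₀ ∣ + ∣ T₀ ∣ + r * s   ≡⟨ cong (λ t → ∣ F₀ ∣ + t + r * s) ∣T₀∣≡s ⟩
      ∣ F₀ ∣ + s + r * s        ≡⟨ +-assoc ∣ F₀ ∣ s (r * s) ⟩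
      ∣ F₀ ∣ + suc r * s        ≤⟨ bound ⟩
      M                         ∎
      where open ≤-Reasoning
    rest = greedy r s M (P ∘ suc) F₁ bound₁ (choose ∘ suc)
    W : Fin (suc r) → Subset _
    W zero    = T₀
    W (suc i) = proj₁ rest i
    W₁∩F₁=∅ : ∀ i → Disjoint (W (suc i)) F₁
    W₁∩F₁=∅ i = proj₁ (proj₂ (proj₁ (proj₂ rest) i))
    good : ∀ i → ∣ W i ∣ ≡ s × Disjoint (W i) F₀ × P i (W i)
    good zero    = proj₂ choice₀
    good (suc i) = let ∣Wi∣≡s , _ , P-Wi = proj₁ (proj₂ rest) i in
      ∣Wi∣≡s , (λ x x∈Wi x∈F₀ → W₁∩F₁=∅ i x x∈Wi (p⊆p∪q T₀ x∈F₀)) , P-Wi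
    disjoint : PairwiseDisjoint W
    disjoint zero    zero     0≢0 = ⊥-elim (0≢0 refl)
    disjoint zero    (suc i)  _   = λ x x∈T₀ x∈Wi → W₁∩F₁=∅ i x x∈Wi (q⊆p∪q F₀ T₀ x∈T₀)
    disjoint (suc i) zero     _   = λ x x∈Wi x∈T₀ → W₁∩F₁=∅ i x x∈Wi (q⊆p∪q F₀ T₀ x∈T₀)
    disjoint (suc i) (suc i′) i≢i′ = proj₂ (proj₂ rest) i i′ (i≢i′ ∘ cong suc)

  large-n⇒gap : ∀ p q j m F M → F ≤ M → suc j * suc (q * suc M) < suc m →
    q * suc F * suc j + 2 * suc p * suc j < 2 * suc p * suc m
  large-n⇒gap p q j m F M F≤M large = begin-strict
    q * suc F * suc j + P * suc j          ≤⟨ +-monoˡ-≤ (P * suc j) (≤-trans q[1+F][1+j]≤q[1+M][1+j] (m≤n*m _ P)) ⟩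
    P * (q * suc M * suc j) + P * suc j    ≡⟨ reorder P q M j ⟩
    P * (suc j * suc (q * suc M))          <⟨ *-monoʳ-< P large ⟩
    P * suc m                              ∎
    where
    open ≤-Reasoning
    P = 2 * suc p
    q[1+F][1+j]≤q[1+M][1+j] : q * suc F * suc j ≤ q * suc M * suc j
    q[1+F][1+j]≤q[1+M][1+j] = *-monoˡ-≤ (suc j) (*-monoʳ-≤ q (s≤s F≤M))
    reorder : ∀ P q M j → P * (q * suc M * suc j) + P * suc j ≡ P * (suc j * suc (q * suc M))
    reorder = solve-∀

  gap⇒ratio : ∀ {a b c d X Y} → 0 < Y → c * (Y + X) ≡ b * Y → a * c + d * c < d * b → a * Y < d * X
  gap⇒ratio {a} {b} {c} {d} {X} {Y} 0<Y absorb gap = *-cancelˡ-< c (a * Y) (d * X) (+-cancelʳ-< (d * c * Y) _ _ (begin-strict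
    c * (a * Y) + d * c * Y   ≡⟨ e₁ a c d Y ⟩
    (a * c + d * c) * Y       <⟨ *-monoˡ-< Y {{>-nonZero 0<Y}} gap ⟩
    d * b * Y                 ≡⟨ *-assoc d b Y ⟩
    d * (b * Y)               ≡⟨ cong (d *_) absorb ⟨
    d * (c * (Y + X))         ≡⟨ e₂ c d X Y ⟩
    c * (d * X) + d * c * Y   ∎))
    where
    open ≤-Reasoning
    e₁ : ∀ a c d Y → c * (a * Y) + d * c * Y ≡ (a * c + d * c) * Y
    e₁ = solve-∀
    e₂ : ∀ c d X Y → d * (c * (Y + X)) ≡ c * (d * X) + d * c * Y
    e₂ = solve-∀

  ratio⇒degree-sum : ∀ {q P X Y F du dv} → (q + 2 * P) * X ≤ 2 * q * du → (q + 2 * P) * X ≤ 2 * q * dv →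
    q * suc F * Y < 2 * P * X → Y + X + F * Y < du + dv
  ratio⇒degree-sum {q} {P} {X} {Y} {F} {du} {dv} du-large dv-large ratio = *-cancelˡ-< (2 * q) _ _ (begin-strict
    2 * q * (Y + X + F * Y)            ≡⟨ e₁ q X Y F ⟩
    2 * q * X + 2 * (q * suc F * Y)    <⟨ +-monoʳ-< (2 * q * X) (*-monoʳ-< 2 ratio) ⟩
    2 * q * X + 2 * (2 * P * X)        ≡⟨ e₂ q P X ⟩
    (q + 2 * P) * X + (q + 2 * P) * X  ≤⟨ +-mono-≤ du-large dv-large ⟩
    2 * q * du + 2 * q * dv            ≡⟨ *-distribˡ-+ (2 * q) du dv ⟨
    2 * q * (du + dv)                  ∎)
    where
    open ≤-Reasoning
    e₁ : ∀ q X Y F → 2 * q * (Y + X + F * Y) ≡ 2 * q * X + 2 * (q * suc F * Y)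
    e₁ = solve-∀
    e₂ : ∀ q P X → 2 * q * X + 2 * (2 * P * X) ≡ (q + 2 * P) * X + (q + 2 * P) * X
    e₂ = solve-∀

  degrees⇒commonLink-premise : ∀ p q j m M {F du dv} → F ≤ M → suc j * suc (q * suc M) < suc m →
    (q + 2 * suc p) * (m C suc j) ≤ 2 * q * du → (q + 2 * suc p) * (m C suc j) ≤ 2 * q * dv →
    suc m C suc j + F * (m C j) < du + dv
  degrees⇒commonLink-premise p q j m M {F} F≤M large du-large dv-large =
    subst (λ Z → Z + F * (m C j) < _) (nCk+nC[k+1]≡[n+1]C[k+1] m j)
      (ratio⇒degree-sum {q} {suc p} {m C suc j} {m C j} {F} du-large dv-large
        (gap⇒ratio {q * suc F} {suc m} {suc j} {2 * suc p} (k≤n⇒0<nCk j≤m) absorb (large-n⇒gap p q j m F M F≤M large)))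
    where
    j≤m : j ≤ m
    j≤m = <⇒≤ (≤-pred (≤-<-trans (m≤m*n (suc j) (suc (q * suc M))) large))
    absorb : suc j * (m C j + m C suc j) ≡ suc m * (m C j)
    absorb = trans (cong (suc j *_) (nCk+nC[k+1]≡[n+1]C[k+1] m j)) ([k+1]*[n+1]C[k+1]≡[n+1]*nCk m j)

  forbiddenBound : ℕ → ℕ
  forbiddenBound j = 2 * (2 + j) + suc j * suc j

  shiftingThreshold : ℕ → ℕ → ℕ
  shiftingThreshold j q = suc (suc j * suc (q * suc (forbiddenBound j)))

  ∣e∪f∣+[k-1]²≤forbiddenBound : ∀ {j n} (G : KGraph (2 + j) n) e f → isEdge G e ≡ true → isEdge G f ≡ true →
    ∣ e ∪ f ∣ + suc j * suc j ≤ forbiddenBound j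
  ∣e∪f∣+[k-1]²≤forbiddenBound {j} G e f e∈G f∈G = +-monoˡ-≤ (suc j * suc j) (begin
    ∣ e ∪ f ∣         ≤⟨ ∣p∪q∣≤∣p∣+∣q∣ e f ⟩
    ∣ e ∣ + ∣ f ∣     ≡⟨ cong₂ _+_ (edgeSize G e e∈G) (edgeSize G f f∈G) ⟩
    (2 + j) + (2 + j) ≡⟨ cong (λ x → (2 + j) + x) (+-identityʳ (2 + j)) ⟨
    2 * (2 + j)       ∎)
    where open ≤-Reasoning

  shiftingStructure : ∀ {j n} (G : KGraph (2 + j) n) e f (v u : Fin (2 + j) → Fin n) (W : Fin (suc j) → Subset n) →
    (∀ i → ∣ W i ∣ ≡ suc j × Disjoint (W i) (e ∪ f) × CommonLink G (u (suc i)) (v (suc i)) (W i)) →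
    PairwiseDisjoint W → ShiftingStructure (s≤s (s≤s z≤n)) G e f v u
  shiftingStructure {j} {n} G e f v u W good disjoint = U , size , apart , pairwise , edges
    where
    U : Fin (2 + j) → Subset n
    U zero    = ⊥
    U (suc i) = W i
    size : ∀ i → i ≢ zero → ∣ U i ∣ ≡ suc j
    size zero    0≢0 = ⊥-elim (0≢0 refl)
    size (suc i) _   = proj₁ (good i)
    apart : ∀ i → i ≢ zero → Disjoint (U i) e × Disjoint (U i) f
    apart zero    0≢0 = ⊥-elim (0≢0 refl)
    apart (suc i) _   = (λ x x∈W x∈e → W∩[e∪f]=∅ x x∈W (p⊆p∪q f x∈e))
                      , (λ x x∈W x∈f → W∩[e∪f]=∅ x x∈W (q⊆p∪q e f x∈f))
      where W∩[e∪f]=∅ = proj₁ (proj₂ (good i))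
    pairwise : ∀ i i′ → i ≢ zero → i′ ≢ zero → i ≢ i′ → Disjoint (U i) (U i′)
    pairwise zero    _        0≢0 _   _    = ⊥-elim (0≢0 refl)
    pairwise (suc i) zero     _   0≢0 _    = ⊥-elim (0≢0 refl)
    pairwise (suc i) (suc i′) _   _   i≢i′ = disjoint i i′ (λ i≡i′ → i≢i′ (cong suc i≡i′))
    edges : ∀ i → i ≢ zero → CommonLink G (u i) (v i) (U i)
    edges zero    0≢0 = ⊥-elim (0≢0 refl)
    edges (suc i) _   = proj₂ (proj₂ (good i))

  n/1≡mkℚ : ∀ n → + n ℚ./ 1 ≡ mkℚ (+ n) 0 (Coprime.sym (1-coprimeTo n))
  n/1≡mkℚ n = ℚ.normalize-coprime (Coprime.sym (1-coprimeTo n))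

  [½+β]*B≤d⇒ᵘ : ∀ P q′ .(c : Coprime P (suc q′)) B d →
    (½ ℚ.+ mkℚ (+ P) q′ c) ℚ.* (+ B ℚ./ 1) ℚ.≤ + d ℚ./ 1 →
    (toℚᵘ ½ ℚᵘ.+ toℚᵘ (mkℚ (+ P) q′ c)) ℚᵘ.* mkℚᵘ (+ B) 0 ℚᵘ.≤ mkℚᵘ (+ d) 0
  [½+β]*B≤d⇒ᵘ P q′ c B d h rewrite n/1≡mkℚ B | n/1≡mkℚ d = ℚᵘ.≤-respˡ-≃
    (ℚᵘ.≃-trans (ℚ.toℚᵘ-homo-* (½ ℚ.+ β) _) (ℚᵘ.*-congʳ (ℚ.toℚᵘ-homo-+ ½ β))) (ℚ.toℚᵘ-mono-≤ h)
    where β = mkℚ (+ P) q′ c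

  [½+β]*B≤d⇒ℕ : ∀ P q′ .(c : Coprime P (suc q′)) {B} d →
    (½ ℚ.+ mkℚ (+ P) q′ c) ℚ.* (+ B ℚ./ 1) ℚ.≤ + d ℚ./ 1 → (suc q′ + 2 * P) * B ≤ 2 * suc q′ * d
  [½+β]*B≤d⇒ℕ P q′ c {B} d h with *≤* le ← [½+β]*B≤d⇒ᵘ P q′ c B d h =
    subst₂ _≤_ (e₁ P q B) (e₂ q d) (ℤ.drop‿+≤+ (subst₂ ℤ._≤_ lhs rhs le))
    where
    q = suc q′
    -- the numerator of the unnormalised product, as computed by ℚᵘ._+_ and ℚᵘ._*_
    lhs : (+ 1 ℤ.* + q ℤ.+ + P ℤ.* + 2) ℤ.* + B ℤ.* + 1 ≡ + ((1 * q + P * 2) * B * 1)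
    lhs = sym (begin
      + ((1 * q + P * 2) * B * 1)                 ≡⟨ ℤ.pos-* ((1 * q + P * 2) * B) 1 ⟩
      + ((1 * q + P * 2) * B) ℤ.* + 1             ≡⟨ cong (ℤ._* + 1) (ℤ.pos-* (1 * q + P * 2) B) ⟩
      + (1 * q + P * 2) ℤ.* + B ℤ.* + 1           ≡⟨ cong (λ z → z ℤ.* + B ℤ.* + 1) (ℤ.pos-+ (1 * q) (P * 2)) ⟩
      (+ (1 * q) ℤ.+ + (P * 2)) ℤ.* + B ℤ.* + 1   ≡⟨ cong₂ (λ x y → (x ℤ.+ y) ℤ.* + B ℤ.* + 1) (ℤ.pos-* 1 q) (ℤ.pos-* P 2) ⟩
      (+ 1 ℤ.* + q ℤ.+ + P ℤ.* + 2) ℤ.* + B ℤ.* + 1 ∎)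
      where open ≡-Reasoning
    rhs : + d ℤ.* + (2 * q * 1) ≡ + (d * (2 * q * 1))
    rhs = sym (ℤ.pos-* d (2 * q * 1))
    e₁ : ∀ P q B → (1 * q + P * 2) * B * 1 ≡ (q + 2 * P) * B
    e₁ = solve-∀
    e₂ : ∀ q d → d * (2 * q * 1) ≡ 2 * q * d
    e₂ = solve-∀

open import Defs
open import Data.Nat using (ℕ; _≤_; _∸_)
open import Data.Nat.Combinatorics using (_C_)
open import Data.Integer using (+_)
open import Data.Rational using (ℚ; ½; 0ℚ; _+_; _*_; _/_; _<_) renaming (_≤_ to _≤ℚ_)
open import Data.Fin using (Fin)
open import Data.Fin.Subset using (Subset; _∈_)
open import Data.Product using (Σ; _×_)
open import Relation.Binary.PropositionalEquality using (_≡_; _≢_)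
open import Data.Bool using (true)
open import Data.Nat using (suc; s≤s; z≤n)
open import Data.Fin using (suc)
open import Data.Fin.Subset using (_∪_)
open import Data.Integer using (+[1+_]; -[1+_])
open import Data.Rational using (mkℚ; positive)
open import Data.Product using (_,_; proj₁; proj₂)

lemma3p8 : (k : ℕ) (hk : 2 ≤ k) (β : ℚ) → 0ℚ < β →
  Σ ℕ λ N → ∀ n → N ≤ n →
    (G : KGraph k n) (e f : Subset n) (v u : Fin k → Fin n) →
    isEdge G e ≡ true → isEdge G f ≡ true →
    Enumerates v e → Enumerates u f →
    u (first hk) ≡ v (first hk) →
    (∀ x → x ∈ e → x ∈ f → x ≡ v (first hk)) →
    (∀ i → i ≢ first hk →
      ((½ + β) * ((+ ((n ∸ 1) C (k ∸ 1))) / 1) ≤ℚ (+ degree G (u i)) / 1)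
      × ((½ + β) * ((+ ((n ∸ 1) C (k ∸ 1))) / 1) ≤ℚ (+ degree G (v i)) / 1)) →
    ShiftingStructure hk G e f v u
lemma3p8 _ (s≤s (s≤s z≤n)) (mkℚ (+ 0) _ _) 0<β with () ← positive 0<β
lemma3p8 _ (s≤s (s≤s z≤n)) (mkℚ -[1+ _ ] _ _) 0<β with () ← positive 0<β
lemma3p8 (suc (suc j)) (s≤s (s≤s z≤n)) (mkℚ +[1+ p ] q′ c) _ = shiftingThreshold j (suc q′) , λ where
  (suc m) large G e f v u e∈G f∈G _ _ _ _ deg →
    let W , good , disjoint = greedy (suc j) (suc j) (forbiddenBound j) (λ i → CommonLink G (u (suc i)) (v (suc i)))
          (e ∪ f) (∣e∪f∣+[k-1]²≤forbiddenBound G e f e∈G f∈G)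
          (λ i F ∣F∣≤M → commonLink-avoiding G F (u (suc i)) (v (suc i))
            (degrees⇒commonLink-premise p (suc q′) j m (forbiddenBound j) ∣F∣≤M large
              ([½+β]*B≤d⇒ℕ (suc p) q′ c (degree G (u (suc i))) (proj₁ (deg (suc i) λ ())))
              ([½+β]*B≤d⇒ℕ (suc p) q′ c (degree G (v (suc i))) (proj₂ (deg (suc i) λ ())))))
    in shiftingStructure G e f v u W good disjoint
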